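{- For nonnegative integers $A,B,C$ with $A$ even, let $D[A,B,C]$ be as defined in the context. If $A>0$ and $B>0$, then $$D[A,B,C] = \Big(C+\frac{A}{2}\Big)\, D[A,B-1,C] + (B-1)\, D[A,B-2,C+1] + \frac{A}{2}\, D[A-2,B-1,C+2].$$
   Context: Let $n\ge 1$. A partial 2-max function is a function $f$ from a subset $S\subseteq\{1,\dots,n\}$ to $\{1,\dots,n\}$ such that every value has at most two preimages. Its parameters are: $A$ = the number of elements $i\in S$ whose image $f(i)$ has exactly two preimages under $f$ (so $A$ is even); $B$ = the number of elements $i\in S$ whose image has exactly one preimage; $C = n-A-B$ = the number of elements of $\{1,\dots,n\}$ on which $f$ is undefined. An $f$-derangement is a permutation $g$ of $\{1,\dots,n\}$ with $g(i)\neq f(i)$ for every $i\in S$. The number of $f$-derangements depends only on $(A,B,C)$ (by relabeling domain and codomain), and is denoted $D[A,B,C]$; here $n=A+B+C$. When an argument involves a negative entry it does not occur since $A,B>0$ ensures all arguments are nonnegative (with $B-2\ge 0$ required for the middle term only when $B\ge 2$; when $B=1$ the middle term has coefficient $0$). -}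

module Defs where

open import Data.Bool using (Bool; true; false; _∧_; not)
open import Data.Nat using (ℕ; zero; suc; _+_; _∸_; _<_; _<?_)
open import Data.Nat.DivMod using (_/_)
open import Data.Fin using (Fin; toℕ; fromℕ<; _≟_)
open import Data.Vec using (Vec; []; _∷_; lookup)
open import Data.List using (List; []; _∷_; map; concatMap; filterᵇ; length; allFin)
open import Data.Bool.ListAction using (all)
open import Data.Maybe using (Maybe; just; nothing)
open import Relation.Nullary.Decidable using (⌊_⌋; yes; no)

-- A partial function from {1..n} to {1..n}, modelled on Fin n:
-- f i = nothing means f is undefined at i (i ∉ S).
PartialFun : ℕ → Set
PartialFun n = Fin n → Maybe (Fin n)

allVecs : (m n : ℕ) → List (Vec (Fin n) m)
allVecs zero    n = [] ∷ []
allVecs (suc m) n = concatMap (λ v → map (λ x → x ∷ v) (allFin n)) (allVecs m n)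

-- g (as a table i ↦ lookup g i) is injective, hence a permutation of Fin n.
isPermutation : ∀ {n} → Vec (Fin n) n → Bool
isPermutation {n} g =
  all (λ i → all (λ j → not ⌊ lookup g i ≟ lookup g j ⌋ ∨' ⌊ i ≟ j ⌋) (allFin n)) (allFin n)
  where
  _∨'_ : Bool → Bool → Bool
  true  ∨' _ = true
  false ∨' b = b

avoids : ∀ {n} → PartialFun n → Vec (Fin n) n → Bool
avoids {n} f g = all (λ i → ok (f i) (lookup g i)) (allFin n)
  where
  ok : Maybe (Fin n) → Fin n → Bool
  ok nothing  _ = true
  ok (just j) x = not ⌊ x ≟ j ⌋

derangements : ∀ {n} → PartialFun n → ℕ
derangements {n} f = length (filterᵇ (λ g → isPermutation g ∧ avoids f g) (allVecs n n))

-- Turn a natural number into an element of Fin n (given that Fin n is inhabited);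
-- used only on values that are provably in range, the fallback never fires.
clamp : ∀ {n} → Fin n → ℕ → Fin n
clamp {n} d k with k <? n
... | yes p = fromℕ< p
... | no  _ = d

-- Canonical partial 2-max function with parameters (A,B,C), A even, n = A+B+C
-- (0-based): positions 2j and 2j+1 (< A) are sent to j  (A/2 values with two preimages);
-- positions A ≤ i < A+B are sent to A/2 + (i - A)  (B values with one preimage,
-- disjoint from the previous ones); positions ≥ A+B are outside S (C of them).
canonical : (A B C : ℕ) → PartialFun (A + B + C)
canonical A B C i with toℕ i <? A
... | yes _ = just (clamp i (toℕ i / 2))
... | no _ with toℕ i <? A + B
...   | yes _ = just (clamp i (A / 2 + (toℕ i ∸ A)))
...   | no _  = nothing

-- D[A,B,C]: the number of f-derangements of a partial 2-max function with
-- parameters (A,B,C) (which depends only on (A,B,C)), computed on the canonical one.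
D : ℕ → ℕ → ℕ → ℕ
D A B C = derangements (canonical A B C)

module Submission where

-- Encode a partial function by its rows, the forbidden value (if any) of each point; its derangements
-- are then the injective assignments of values to rows avoiding the forbidden ones. Their number only
-- depends on the shape: a values forbidden twice, b forbidden once, c points outside the domain and
-- d values forbidden for no point, since relabelling the values preserves it. Call it P(a,b,c,d), so
-- D[2a,B,C] = P(a,B,C,a+C). Expanding a row whose value e is forbidden once along the value y it gets,
--   P(a,b+1,c,d) = a P(a-1,b,c+2,d+1) + b P(a,b-1,c+1,d+1) + d P(a,b,c,d):
-- once y is taken, the rows forbidding y become unrestricted (two of them if y is forbidden twice),
-- e joins the unused values, and y leaves them if it was one of them.

open import Defs
open import Data.Bool using (Bool; true; false; not; _∧_; T)
open import Data.Bool.ListAction using (all)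
open import Data.Bool.Properties using (T-∧; ⇔→≡; T-≡; T?)
open import Data.Empty using (⊥-elim)
open import Data.Fin using (Fin; toℕ) renaming (zero to fzero; suc to fsuc; _≟_ to _≟ᶠ_)
open import Data.Fin.Properties using (toℕ-injective; toℕ<n; toℕ-fromℕ<; ¬∀⟶∃¬)
import Data.Fin.Properties as Fin
open import Data.List
  using (List; []; _∷_; _++_; length; map; replicate; concatMap; filter; filterᵇ; allFin; tabulate)
open import Data.List.Properties
  using (map-++; length-++; length-map; ∷-injective; map-∘; map-replicate; map-cong;
         filter-accept; filter-reject; filter-all; map-tabulate; tabulate-cong)
open import Data.List.Membership.Propositional using (_∈_; _∉_)
open import Data.List.Membership.Propositional.Properties using (∈-++⁺ʳ; ∈-filter⁺; ∈-filter⁻; ∈-allFin)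
open import Data.List.Membership.Propositional.Properties.WithK using (unique∧set⇒bag)
open import Data.List.Relation.Binary.BagAndSetEquality using (∼bag⇒↭)
open import Data.List.Relation.Binary.Permutation.Propositional as ↭
  using (_↭_; prep; swap; ↭-sym; ↭⇒↭ₛ)
open import Data.List.Relation.Binary.Permutation.Propositional.Properties
  using (shift; shifts; ++⁺ˡ; ++⁺ʳ; map⁺; ∈-resp-↭; All-resp-↭; ↭-length)
open import Data.List.Relation.Unary.All as All using (All; []; _∷_)
import Data.List.Relation.Unary.All.Properties as All
open import Data.List.Relation.Unary.Any as Any using (here; there)
open import Data.List.Relation.Unary.Unique.Propositional using (Unique; []; _∷_)
import Data.List.Relation.Unary.Unique.Propositional.Properties as Unique
open import Data.List.Relation.Unary.Unique.Propositional.Properties using (Unique[x∷xs]⇒x∉xs)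
open import Data.Maybe as Maybe using (Maybe; just; nothing)
import Data.Maybe.Relation.Unary.All as MaybeAll
open import Data.Nat using (ℕ; zero; suc; _+_; _*_; _∸_; _<_; _≤_; s≤s; z≤n; _≟_; _<?_)
open import Data.Nat.Divisibility using (_∣_; divides)
open import Data.Nat.DivMod using (_/_; m/n≤m; m*n/n≡m; m/n≡1+[m∸n]/n)
open import Data.Nat.ListAction using (sum)
open import Data.Nat.ListAction.Properties using (sum-++; sum-↭)
open import Data.Nat.Properties
open import Algebra.Properties.CommutativeSemigroup +-commutativeSemigroup
  using (interchange) renaming (x∙yz≈y∙xz to +-leftComm)
open import Algebra.Properties.CommutativeSemigroup *-commutativeSemigroup
  using () renaming (x∙yz≈y∙xz to *-leftComm)
open import Data.Nat.Tactic.RingSolver using (solve-∀)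
open import Data.Product using (_×_; _,_; proj₁; proj₂)
open import Data.Unit using (tt)
open import Data.Vec using (Vec; []; _∷_; lookup)
open import Function using (id; _∘_; _∘′_; _⇔_; mk⇔; Equivalence; case_of_)
open import Function.Definitions using (Injective)
open import Relation.Binary.PropositionalEquality
open import Relation.Nullary.Decidable
  using (Dec; does; yes; no; dec-true; dec-false; ¬?; toWitness; fromWitness; isYes≗does)
open import Relation.Unary using (Decidable)
open import Data.List.Membership.DecPropositional _≟_ using (_∈?_)
open import Data.List.Relation.Binary.Permutation.Setoid.Properties (setoid ℕ) using (Unique-resp-↭)

map-cong-All : ∀ {A B : Set} {f g : A → B} {xs} → All (λ z → f z ≡ g z) xs → map f xs ≡ map g xs
map-cong-All []         = refl
map-cong-All (eq ∷ eqs) = cong₂ _∷_ eq (map-cong-All eqs)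

++-injective : ∀ {A : Set} (xs xs′ : List A) {ys ys′} →
               length xs ≡ length xs′ → xs ++ ys ≡ xs′ ++ ys′ → xs ≡ xs′ × ys ≡ ys′
++-injective []       []         _   eq = refl , eq
++-injective (x ∷ xs) (x′ ∷ xs′) len eq with ∷-injective eq
... | refl , eq′ with ++-injective xs xs′ (suc-injective len) eq′
...   | refl , ys≡ = refl , ys≡

cong₃ : ∀ (f : ℕ → ℕ → ℕ → ℕ) {x x′ y y′ z z′} → x ≡ x′ → y ≡ y′ → z ≡ z′ → f x y z ≡ f x′ y′ z′
cong₃ f refl refl refl = refl

unique-resp-↭ : ∀ {xs ys : List ℕ} → xs ↭ ys → Unique xs → Unique ys
unique-resp-↭ p = Unique-resp-↭ (↭⇒↭ₛ p)

toFront : ∀ {A : Set} (xs : List A) {ys y rest} → ys ↭ y ∷ rest → xs ++ ys ↭ y ∷ xs ++ rest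
toFront xs {y = y} {rest} p = ↭.trans (++⁺ˡ xs p) (shift y xs rest)

-- Sums over the ways of picking an element

module _ {A : Set} where

  pickSum : (A → List A → ℕ) → List A → ℕ
  pickSum h []       = 0
  pickSum h (x ∷ xs) = h x xs + pickSum (λ y rest → h y (x ∷ rest)) xs

  pickSum-cong : ∀ {h h′ : A → List A → ℕ} → (∀ y rest → h y rest ≡ h′ y rest) →
                 ∀ xs → pickSum h xs ≡ pickSum h′ xs
  pickSum-cong eq []       = refl
  pickSum-cong eq (x ∷ xs) = cong₂ _+_ (eq x xs) (pickSum-cong (λ y rest → eq y (x ∷ rest)) xs)

  pickSum-cong-↭ : ∀ xs {h h′ : A → List A → ℕ} →
    (∀ y rest → xs ↭ y ∷ rest → h y rest ≡ h′ y rest) → pickSum h xs ≡ pickSum h′ xs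
  pickSum-cong-↭ []       eq = refl
  pickSum-cong-↭ (x ∷ xs) eq = cong₂ _+_ (eq x xs ↭.refl)
    (pickSum-cong-↭ xs (λ y rest p → eq y (x ∷ rest) (↭.trans (prep x p) (swap x y ↭.refl))))

  pickSum-+ : ∀ (h g : A → List A → ℕ) xs →
              pickSum (λ y rest → h y rest + g y rest) xs ≡ pickSum h xs + pickSum g xs
  pickSum-+ h g []       = refl
  pickSum-+ h g (x ∷ xs) =
    trans (cong ((h x xs + g x xs) +_) (pickSum-+ (λ y rest → h y (x ∷ rest)) _ xs))
          (interchange (h x xs) (g x xs) _ _)

  *-distribˡ-pickSum : ∀ k (h : A → List A → ℕ) xs →
                       k * pickSum h xs ≡ pickSum (λ y rest → k * h y rest) xs
  *-distribˡ-pickSum k h []       = *-zeroʳ k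
  *-distribˡ-pickSum k h (x ∷ xs) =
    trans (*-distribˡ-+ k (h x xs) _) (cong (k * h x xs +_) (*-distribˡ-pickSum k _ xs))

  pickSum-const : ∀ K xs → pickSum (λ _ _ → K) xs ≡ length xs * K
  pickSum-const K []       = refl
  pickSum-const K (x ∷ xs) = cong (K +_) (pickSum-const K xs)

  pickSum-uniform : ∀ xs {h : A → List A → ℕ} {K} →
    (∀ y rest → xs ↭ y ∷ rest → h y rest ≡ K) → pickSum h xs ≡ length xs * K
  pickSum-uniform xs {K = K} eq = trans (pickSum-cong-↭ xs eq) (pickSum-const K xs)

  pickSum-++ : ∀ (h : A → List A → ℕ) xs ys →
    pickSum h (xs ++ ys) ≡ pickSum (λ y rest → h y (rest ++ ys)) xs + pickSum (λ y rest → h y (xs ++ rest)) ys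
  pickSum-++ h []       ys = refl
  pickSum-++ h (x ∷ xs) ys =
    trans (cong (h x (xs ++ ys) +_) (pickSum-++ (λ y rest → h y (x ∷ rest)) xs ys))
          (sym (+-assoc (h x (xs ++ ys)) _ _))

  pickSum-↭ : ∀ {h : A → List A → ℕ} → (∀ y {rest rest′} → rest ↭ rest′ → h y rest ≡ h y rest′) →
              ∀ {xs ys} → xs ↭ ys → pickSum h xs ≡ pickSum h ys
  pickSum-↭ h-↭ ↭.refl           = refl
  pickSum-↭ h-↭ (prep x p)       = cong₂ _+_ (h-↭ x p) (pickSum-↭ (λ y q → h-↭ y (prep x q)) p)
  pickSum-↭ h-↭ (↭.trans p q)    = trans (pickSum-↭ h-↭ p) (pickSum-↭ h-↭ q)
  pickSum-↭ {h} h-↭ (swap {xs} {ys} x y p) = begin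
    h x (y ∷ xs) + (h y (x ∷ xs) + pickSum (λ z r → h z (x ∷ y ∷ r)) xs)
      ≡⟨ cong₂ (λ a b → a + (b + pickSum (λ z r → h z (x ∷ y ∷ r)) xs)) (h-↭ x (prep y p)) (h-↭ y (prep x p)) ⟩
    h x (y ∷ ys) + (h y (x ∷ ys) + pickSum (λ z r → h z (x ∷ y ∷ r)) xs)
      ≡⟨ +-leftComm (h x (y ∷ ys)) (h y (x ∷ ys)) _ ⟩
    h y (x ∷ ys) + (h x (y ∷ ys) + pickSum (λ z r → h z (x ∷ y ∷ r)) xs)
      ≡⟨ cong (λ t → h y (x ∷ ys) + (h x (y ∷ ys) + t)) rest-↭ ⟩
    h y (x ∷ ys) + (h x (y ∷ ys) + pickSum (λ z r → h z (y ∷ x ∷ r)) ys) ∎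
    where
    open ≡-Reasoning
    rest-↭ : pickSum (λ z r → h z (x ∷ y ∷ r)) xs ≡ pickSum (λ z r → h z (y ∷ x ∷ r)) ys
    rest-↭ = trans (pickSum-↭ (λ z q → h-↭ z (prep x (prep y q))) p)
                   (pickSum-cong (λ z r → h-↭ z (swap x y ↭.refl)) ys)

  pickSum₂ : (A → A → List A → ℕ) → List A → ℕ
  pickSum₂ g = pickSum (λ y₁ r₁ → pickSum (λ y₂ r₂ → g y₁ y₂ r₂) r₁)

  pickSum₂-comm : ∀ (g : A → A → List A → ℕ) xs → pickSum₂ g xs ≡ pickSum₂ (λ a b → g b a) xs
  pickSum₂-comm g []       = refl
  pickSum₂-comm g (x ∷ xs) = begin
    pickSum (g x) xs + pickSum (λ y r → g y x r + pickSum (λ z r′ → g y z (x ∷ r′)) r) xs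
      ≡⟨ cong (pickSum (g x) xs +_) (pickSum-+ (λ y → g y x) _ xs) ⟩
    pickSum (g x) xs + (pickSum (λ y → g y x) xs + pickSum₂ (λ a b r → g a b (x ∷ r)) xs)
      ≡⟨ cong (λ t → pickSum (g x) xs + (pickSum (λ y → g y x) xs + t))
              (pickSum₂-comm (λ a b r → g a b (x ∷ r)) xs) ⟩
    pickSum (g x) xs + (pickSum (λ y → g y x) xs + pickSum₂ (λ a b r → g b a (x ∷ r)) xs)
      ≡⟨ +-leftComm (pickSum (g x) xs) (pickSum (λ y → g y x) xs) _ ⟩
    pickSum (λ y → g y x) xs + (pickSum (g x) xs + pickSum₂ (λ a b r → g b a (x ∷ r)) xs)
      ≡⟨ cong (pickSum (λ y → g y x) xs +_) (sym (pickSum-+ (g x) _ xs)) ⟩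
    pickSum (λ y → g y x) xs + pickSum (λ y r → g x y r + pickSum (λ z r′ → g z y (x ∷ r′)) r) xs ∎
    where open ≡-Reasoning

  pickSum-map : ∀ (φ : A → A) (h : A → List A → ℕ) xs →
                pickSum h (map φ xs) ≡ pickSum (λ y rest → h (φ y) (map φ rest)) xs
  pickSum-map φ h []       = refl
  pickSum-map φ h (x ∷ xs) = cong (h (φ x) (map φ xs) +_) (pickSum-map φ (λ y r → h y (φ x ∷ r)) xs)

χ : Bool → ℕ
χ true  = 1
χ false = 0

-- A row is a point of the domain, given by its forbidden value (if any).
allows : Maybe ℕ → ℕ → Bool
allows nothing  _ = true
allows (just z) y = not (does (z ≟ y))

matchings : List (Maybe ℕ) → List ℕ → ℕ
matchings []       cod = 1
matchings (r ∷ rs) cod = pickSum (λ y rest → χ (allows r y) * matchings rs rest) cod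

allows-self : ∀ y → allows (just y) y ≡ false
allows-self y = cong not (dec-true (y ≟ y) refl)

allows-≢ : ∀ {y z} → y ≢ z → allows (just z) y ≡ true
allows-≢ {y} {z} y≢z = cong not (dec-false (z ≟ y) (y≢z ∘′ sym))

T-allows-≢ : ∀ {y z} → y ≢ z → T (allows (just z) y)
T-allows-≢ y≢z = subst T (sym (allows-≢ y≢z)) tt

T-allows⇒≢ : ∀ {y z} → T (allows (just z) y) → y ≢ z
T-allows⇒≢ {y} t refl = subst T (allows-self y) t

matchings-resp-↭ᶜ : ∀ rs {cod cod′} → cod ↭ cod′ → matchings rs cod ≡ matchings rs cod′
matchings-resp-↭ᶜ []       p = refl
matchings-resp-↭ᶜ (r ∷ rs) p = pickSum-↭ (λ y q → cong (χ (allows r y) *_) (matchings-resp-↭ᶜ rs q)) p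

matchings-resp-↭ʳ : ∀ {rs rs′} → rs ↭ rs′ → ∀ cod → matchings rs cod ≡ matchings rs′ cod
matchings-resp-↭ʳ ↭.refl          cod = refl
matchings-resp-↭ʳ (prep r p)      cod = pickSum-cong (λ y rest → cong (χ (allows r y) *_) (matchings-resp-↭ʳ p rest)) cod
matchings-resp-↭ʳ (↭.trans p q)   cod = trans (matchings-resp-↭ʳ p cod) (matchings-resp-↭ʳ q cod)
matchings-resp-↭ʳ (swap {rs} {rs′} r₁ r₂ p) cod = begin
  matchings (r₁ ∷ r₂ ∷ rs) cod
    ≡⟨ expand r₁ r₂ rs ⟩
  pickSum₂ (λ a b rest → χ (allows r₁ a) * (χ (allows r₂ b) * matchings rs rest)) cod
    ≡⟨ pickSum₂-comm _ cod ⟩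
  pickSum₂ (λ a b rest → χ (allows r₁ b) * (χ (allows r₂ a) * matchings rs rest)) cod
    ≡⟨ pickSum-cong (λ a → pickSum-cong (λ b rest →
         trans (*-leftComm (χ (allows r₁ b)) (χ (allows r₂ a)) (matchings rs rest))
               (cong (λ m → χ (allows r₂ a) * (χ (allows r₁ b) * m)) (matchings-resp-↭ʳ p rest)))) cod ⟩
  pickSum₂ (λ a b rest → χ (allows r₂ a) * (χ (allows r₁ b) * matchings rs′ rest)) cod
    ≡⟨ expand r₂ r₁ rs′ ⟨
  matchings (r₂ ∷ r₁ ∷ rs′) cod ∎
  where
  open ≡-Reasoning
  expand : ∀ s₁ s₂ ss → matchings (s₁ ∷ s₂ ∷ ss) cod
         ≡ pickSum₂ (λ a b rest → χ (allows s₁ a) * (χ (allows s₂ b) * matchings ss rest)) cod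
  expand s₁ s₂ ss = pickSum-cong (λ y rest → *-distribˡ-pickSum (χ (allows s₁ y)) _ rest) cod

matchings-prune : ∀ y rs cod → y ∉ cod → matchings (just y ∷ rs) cod ≡ matchings (nothing ∷ rs) cod
matchings-prune y rs cod y∉cod = pickSum-cong-↭ cod λ z rest p →
  cong (λ b → χ b * matchings rs rest)
       (allows-≢ {z} {y} (λ { refl → y∉cod (∈-resp-↭ (↭-sym p) (here refl)) }))

matchings-prune-pair : ∀ y rs cod → y ∉ cod →
  matchings (just y ∷ just y ∷ rs) cod ≡ matchings (nothing ∷ nothing ∷ rs) cod
matchings-prune-pair y rs cod y∉cod = begin
  matchings (just y ∷ just y ∷ rs) cod    ≡⟨ matchings-prune y (just y ∷ rs) cod y∉cod ⟩
  matchings (nothing ∷ just y ∷ rs) cod   ≡⟨ matchings-resp-↭ʳ (swap nothing (just y) (↭.↭-refl {x = rs})) cod ⟩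
  matchings (just y ∷ nothing ∷ rs) cod   ≡⟨ matchings-prune y (nothing ∷ rs) cod y∉cod ⟩
  matchings (nothing ∷ nothing ∷ rs) cod  ∎
  where open ≡-Reasoning

-- Relabelling values

module _ (φ : ℕ → ℕ) {Q : ℕ → Set} (φ-inj : ∀ {x y} → Q x → Q y → φ x ≡ φ y → x ≡ y) where

  allows-relabel : ∀ {r y} → MaybeAll.All Q r → Q y → allows (Maybe.map φ r) (φ y) ≡ allows r y
  allows-relabel             MaybeAll.nothing   qy = refl
  allows-relabel {just z} {y} (MaybeAll.just qz) qy with z ≟ y
  ... | yes refl = cong not (trans (dec-true (φ z ≟ φ z) refl) (sym (dec-true (z ≟ z) refl)))
  ... | no  z≢y  = cong not (trans (dec-false (φ z ≟ φ y) (z≢y ∘′ φ-inj qz qy)) (sym (dec-false (z ≟ y) z≢y)))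

  matchings-relabel : ∀ rs cod → All (MaybeAll.All Q) rs → All Q cod →
                      matchings (map (Maybe.map φ) rs) (map φ cod) ≡ matchings rs cod
  matchings-relabel []       cod []         qcod = refl
  matchings-relabel (r ∷ rs) cod (qr ∷ qrs) qcod =
    trans (pickSum-map φ _ cod) (pickSum-cong-↭ cod λ y rest p →
      cong₂ (λ b m → χ b * m) (allows-relabel qr (All.head (All-resp-↭ p qcod)))
                              (matchings-relabel rs rest qrs (All.tail (All-resp-↭ p qcod))))

lookupZip : List ℕ → List ℕ → ℕ → ℕ
lookupZip (x ∷ xs) (x′ ∷ xs′) z with z ≟ x
... | yes _ = x′
... | no  _ = lookupZip xs xs′ z
lookupZip _ _ z = z

map-lookupZip : ∀ L L′ → Unique L → length L ≡ length L′ → map (lookupZip L L′) L ≡ L′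
map-lookupZip []       []         _              _   = refl
map-lookupZip (x ∷ xs) (x′ ∷ xs′) (x≢xs ∷ uxs) len with x ≟ x
... | no x≢x = ⊥-elim (x≢x refl)
... | yes _  = cong (x′ ∷_) (trans (map-cong-All (All.map skip x≢xs))
                                   (map-lookupZip xs xs′ uxs (suc-injective len)))
  where
  skip : ∀ {z} → x ≢ z → lookupZip (x ∷ xs) (x′ ∷ xs′) z ≡ lookupZip xs xs′ z
  skip {z} x≢z with z ≟ x
  ... | yes z≡x = ⊥-elim (x≢z (sym z≡x))
  ... | no  _   = refl

lookupZip-∈ : ∀ L L′ {z} → length L ≡ length L′ → z ∈ L → lookupZip L L′ z ∈ L′
lookupZip-∈ (x ∷ xs) (x′ ∷ xs′) {z} len z∈ with z ≟ x
... | yes _   = here refl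
... | no z≢x  = there (lookupZip-∈ xs xs′ (suc-injective len) (Any.tail z≢x z∈))

lookupZip-injective : ∀ L L′ → Unique L′ → length L ≡ length L′ →
  ∀ {z w} → z ∈ L → w ∈ L → lookupZip L L′ z ≡ lookupZip L L′ w → z ≡ w
lookupZip-injective (x ∷ xs) (x′ ∷ xs′) (x′≢xs′ ∷ uxs′) len {z} {w} z∈ w∈ eq with z ≟ x | w ≟ x
... | yes z≡x | yes w≡x = trans z≡x (sym w≡x)
... | yes _   | no w≢x  = ⊥-elim (All.lookup x′≢xs′ (lookupZip-∈ xs xs′ (suc-injective len) (Any.tail w≢x w∈)) eq)
... | no z≢x  | yes _   = ⊥-elim (All.lookup x′≢xs′ (lookupZip-∈ xs xs′ (suc-injective len) (Any.tail z≢x z∈)) (sym eq))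
... | no z≢x  | no w≢x  = lookupZip-injective xs xs′ uxs′ (suc-injective len) (Any.tail z≢x z∈) (Any.tail w≢x w∈) eq

doubled : List ℕ → List (Maybe ℕ)
doubled []       = []
doubled (x ∷ xs) = just x ∷ just x ∷ doubled xs

-- Ps: values with two preimages, Ss: values with one preimage,
-- c: points outside the domain, Fs: values that are not forbidden.
blockRows : List ℕ → List ℕ → ℕ → List (Maybe ℕ)
blockRows Ps Ss c = doubled Ps ++ map just Ss ++ replicate c nothing

blockCount : List ℕ → List ℕ → ℕ → List ℕ → ℕ
blockCount Ps Ss c Fs = matchings (blockRows Ps Ss c) (Ps ++ Ss ++ Fs)

map-doubled : ∀ (φ : ℕ → ℕ) xs → map (Maybe.map φ) (doubled xs) ≡ doubled (map φ xs)
map-doubled φ []       = refl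
map-doubled φ (x ∷ xs) = cong (λ t → just (φ x) ∷ just (φ x) ∷ t) (map-doubled φ xs)

map-blockRows : ∀ (φ : ℕ → ℕ) Ps Ss c →
                map (Maybe.map φ) (blockRows Ps Ss c) ≡ blockRows (map φ Ps) (map φ Ss) c
map-blockRows φ Ps Ss c = begin
  map (Maybe.map φ) (doubled Ps ++ map just Ss ++ replicate c nothing)
    ≡⟨ map-++ (Maybe.map φ) (doubled Ps) _ ⟩
  map (Maybe.map φ) (doubled Ps) ++ map (Maybe.map φ) (map just Ss ++ replicate c nothing)
    ≡⟨ cong₂ _++_ (map-doubled φ Ps) (map-++ (Maybe.map φ) (map just Ss) _) ⟩
  doubled (map φ Ps) ++ map (Maybe.map φ) (map just Ss) ++ map (Maybe.map φ) (replicate c nothing)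
    ≡⟨ cong₂ (λ u v → doubled (map φ Ps) ++ u ++ v)
             (trans (sym (map-∘ Ss)) (map-∘ Ss)) (map-replicate (Maybe.map φ) c nothing) ⟩
  blockRows (map φ Ps) (map φ Ss) c ∎
  where open ≡-Reasoning

blockRows-All : ∀ {Q : ℕ → Set} {Ps Ss} c → All Q Ps → All Q Ss →
                All (MaybeAll.All Q) (blockRows Ps Ss c)
blockRows-All c qPs qSs = All.++⁺ (doubled-All qPs) (All.++⁺ (All.map⁺ (All.map MaybeAll.just qSs)) (replicate-All c))
  where
  doubled-All : ∀ {Q : ℕ → Set} {xs} → All Q xs → All (MaybeAll.All Q) (doubled xs)
  doubled-All []         = []
  doubled-All (q ∷ qs) = MaybeAll.just q ∷ MaybeAll.just q ∷ doubled-All qs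
  replicate-All : ∀ {Q : ℕ → Set} c → All (MaybeAll.All Q) (replicate c nothing)
  replicate-All zero    = []
  replicate-All (suc c) = MaybeAll.nothing ∷ replicate-All c

-- Relabel along lookupZip, which is injective on the (duplicate-free) values involved.
blockCount-resp-length : ∀ Ps Ss c Fs Ps′ Ss′ Fs′ →
  Unique (Ps ++ Ss ++ Fs) → Unique (Ps′ ++ Ss′ ++ Fs′) →
  length Ps ≡ length Ps′ → length Ss ≡ length Ss′ → length Fs ≡ length Fs′ →
  blockCount Ps Ss c Fs ≡ blockCount Ps′ Ss′ c Fs′
blockCount-resp-length Ps Ss c Fs Ps′ Ss′ Fs′ u u′ lenP lenS lenF = begin
  matchings (blockRows Ps Ss c) L
    ≡⟨ matchings-relabel φ φ-inj (blockRows Ps Ss c) L rows-in-L (All.tabulate id) ⟨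
  matchings (map (Maybe.map φ) (blockRows Ps Ss c)) (map φ L)
    ≡⟨ cong₂ matchings (trans (map-blockRows φ Ps Ss c) (cong₂ (λ u v → blockRows u v c) φPs φSs)) φL ⟩
  matchings (blockRows Ps′ Ss′ c) L′ ∎
  where
  open ≡-Reasoning
  L  = Ps ++ Ss ++ Fs
  L′ = Ps′ ++ Ss′ ++ Fs′
  lenL : length L ≡ length L′
  lenL = begin
    length (Ps ++ Ss ++ Fs)              ≡⟨ length-++ Ps ⟩
    length Ps + length (Ss ++ Fs)        ≡⟨ cong (length Ps +_) (length-++ Ss) ⟩
    length Ps + (length Ss + length Fs)  ≡⟨ cong₂ _+_ lenP (cong₂ _+_ lenS lenF) ⟩
    length Ps′ + (length Ss′ + length Fs′) ≡⟨ cong (length Ps′ +_) (length-++ Ss′) ⟨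
    length Ps′ + length (Ss′ ++ Fs′)     ≡⟨ length-++ Ps′ ⟨
    length (Ps′ ++ Ss′ ++ Fs′)           ∎
  φ = lookupZip L L′
  φ-inj : ∀ {x y} → x ∈ L → y ∈ L → φ x ≡ φ y → x ≡ y
  φ-inj = lookupZip-injective L L′ u′ lenL
  φL : map φ L ≡ L′
  φL = map-lookupZip L L′ u lenL
  split₁ = ++-injective (map φ Ps) Ps′ (trans (length-map φ Ps) lenP) (trans (sym (map-++ φ Ps (Ss ++ Fs))) φL)
  φPs = proj₁ split₁
  φSs = proj₁ (++-injective (map φ Ss) Ss′ (trans (length-map φ Ss) lenS)
                            (trans (sym (map-++ φ Ss Fs)) (proj₂ split₁)))
  rows-in-L : All (MaybeAll.All (_∈ L)) (blockRows Ps Ss c)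
  rows-in-L with All.++⁻ Ps (All.tabulate {xs = L} id)
  ... | inPs , inSsFs = blockRows-All c inPs (All.++⁻ˡ Ss inSsFs)

range : ℕ → ℕ → List ℕ
range s zero    = []
range s (suc n) = s ∷ range (suc s) n

length-range : ∀ s n → length (range s n) ≡ n
length-range s zero    = refl
length-range s (suc n) = cong suc (length-range (suc s) n)

range-+ : ∀ s m n → range s (m + n) ≡ range s m ++ range (s + m) n
range-+ s zero    n = cong (λ t → range t n) (sym (+-identityʳ s))
range-+ s (suc m) n = cong (s ∷_) (trans (range-+ (suc s) m n) (cong (λ t → range (suc s) m ++ range t n) (sym (+-suc s m))))

range-≥ : ∀ s n {x} → x ∈ range s n → s ≤ x
range-≥ s (suc n) (here refl) = ≤-refl
range-≥ s (suc n) (there x∈)  = <⇒≤ (range-≥ (suc s) n x∈)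

range-unique : ∀ s n → Unique (range s n)
range-unique s zero    = []
range-unique s (suc n) = All.tabulate (λ x∈ s≡x → 1+n≰n (subst (suc s ≤_) (sym s≡x) (range-≥ (suc s) n x∈)))
                       ∷ range-unique (suc s) n

range-∈ : ∀ s n {i} → i < n → s + i ∈ range s n
range-∈ s (suc n) {zero}  _         = here (+-identityʳ s)
range-∈ s (suc n) {suc i} (s≤s i<n) = there (subst (_∈ range (suc s) n) (sym (+-suc s i)) (range-∈ (suc s) n i<n))

range-split : ∀ a b d → range 0 a ++ range a b ++ range (a + b) d ≡ range 0 (a + (b + d))
range-split a b d = sym (trans (range-+ 0 a (b + d)) (cong (range 0 a ++_) (range-+ a b d)))

tabulate-range : ∀ {A : Set} (g : ℕ → A) k s → tabulate {n = k} (λ i → g (s + toℕ i)) ≡ map g (range s k)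
tabulate-range g zero    s = refl
tabulate-range g (suc k) s = cong₂ _∷_ (cong g (+-identityʳ s))
  (trans (tabulate-cong (λ i → cong g (+-suc s (toℕ i)))) (tabulate-range g k (suc s)))

-- P(a,b,c,d), realised on the values 0, 1, 2, …
patternCount : ℕ → ℕ → ℕ → ℕ → ℕ
patternCount a b c d = blockCount (range 0 a) (range a b) c (range (a + b) d)

blockCount≡patternCount : ∀ Ps Ss c Fs → Unique (Ps ++ Ss ++ Fs) →
  blockCount Ps Ss c Fs ≡ patternCount (length Ps) (length Ss) c (length Fs)
blockCount≡patternCount Ps Ss c Fs u =
  blockCount-resp-length Ps Ss c Fs (range 0 (length Ps)) (range (length Ps) (length Ss))
    (range (length Ps + length Ss) (length Fs))
    u (subst Unique (sym (range-split (length Ps) (length Ss) (length Fs))) (range-unique 0 _))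
    (sym (length-range _ _)) (sym (length-range _ _)) (sym (length-range _ _))

-- The recurrence for block shapes

doubled-↭ : ∀ {xs ys} → xs ↭ ys → doubled xs ↭ doubled ys
doubled-↭ ↭.refl         = ↭.refl
doubled-↭ (prep x p)     = prep (just x) (prep (just x) (doubled-↭ p))
doubled-↭ (↭.trans p q)  = ↭.trans (doubled-↭ p) (doubled-↭ q)
doubled-↭ (swap x y p)   = ↭.trans (shifts (just x ∷ just x ∷ []) (just y ∷ just y ∷ []))
  (prep (just y) (prep (just y) (prep (just x) (prep (just x) (doubled-↭ p)))))

blockRows-↭-paired : ∀ {Ps} y rest Ss c → Ps ↭ y ∷ rest →
  blockRows Ps Ss c ↭ just y ∷ just y ∷ blockRows rest Ss c
blockRows-↭-paired y rest Ss c p = ++⁺ʳ (map just Ss ++ replicate c nothing) (doubled-↭ p)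

blockRows-↭-single : ∀ Ps {Ss} y rest c → Ss ↭ y ∷ rest →
  blockRows Ps Ss c ↭ just y ∷ blockRows Ps rest c
blockRows-↭-single Ps y rest c p = toFront {Maybe ℕ} (doubled Ps) (++⁺ʳ (replicate c nothing) (map⁺ just p))

blockRows-suc : ∀ Ps Ss c → nothing ∷ blockRows Ps Ss c ↭ blockRows Ps Ss (suc c)
blockRows-suc Ps Ss c =
  ↭.trans (shifts (nothing ∷ []) (doubled Ps)) (++⁺ˡ (doubled Ps) (shifts (nothing ∷ []) (map just Ss)))

-- Below, e is the forbidden value of the expanded row and y ≠ e is the value it receives.
χ-allows-fresh : ∀ {e y : ℕ} {rest} m → Unique (y ∷ rest) → e ∈ rest → χ (allows (just e) y) * m ≡ m
χ-allows-fresh m (y≢rest ∷ _) e∈ = trans (cong (λ b → χ b * m) (allows-≢ (All.lookup y≢rest e∈))) (*-identityˡ m)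

length-pick : ∀ {xs : List ℕ} {y rest} → xs ↭ y ∷ rest → length rest ≡ length xs ∸ 1
length-pick p = cong (_∸ 1) (sym (↭-length p))

expand-paired : ∀ e {Ps} y rest Ss c Fs → Ps ↭ y ∷ rest → Unique (y ∷ rest ++ e ∷ Ss ++ Fs) →
  χ (allows (just e) y) * matchings (blockRows Ps Ss c) (rest ++ e ∷ Ss ++ Fs)
  ≡ patternCount (length Ps ∸ 1) (length Ss) (2 + c) (suc (length Fs))
expand-paired e {Ps} y rest Ss c Fs p u@(_ ∷ u′) = begin
  χ (allows (just e) y) * matchings (blockRows Ps Ss c) cod
    ≡⟨ χ-allows-fresh (matchings (blockRows Ps Ss c) cod) u (∈-++⁺ʳ rest (here refl)) ⟩
  matchings (blockRows Ps Ss c) cod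
    ≡⟨ matchings-resp-↭ʳ (blockRows-↭-paired y rest Ss c p) cod ⟩
  matchings (just y ∷ just y ∷ blockRows rest Ss c) cod
    ≡⟨ matchings-prune-pair y (blockRows rest Ss c) cod (Unique[x∷xs]⇒x∉xs u) ⟩
  matchings (nothing ∷ nothing ∷ blockRows rest Ss c) cod
    ≡⟨ matchings-resp-↭ʳ (↭.trans (prep nothing (blockRows-suc rest Ss c)) (blockRows-suc rest Ss (suc c))) cod ⟩
  matchings (blockRows rest Ss (2 + c)) cod
    ≡⟨ matchings-resp-↭ᶜ (blockRows rest Ss (2 + c)) cod↭ ⟩
  blockCount rest Ss (2 + c) (e ∷ Fs)
    ≡⟨ blockCount≡patternCount rest Ss (2 + c) (e ∷ Fs) (unique-resp-↭ cod↭ u′) ⟩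
  patternCount (length rest) (length Ss) (2 + c) (suc (length Fs))
    ≡⟨ cong (λ a → patternCount a (length Ss) (2 + c) (suc (length Fs))) (length-pick p) ⟩
  patternCount (length Ps ∸ 1) (length Ss) (2 + c) (suc (length Fs)) ∎
  where
  open ≡-Reasoning
  cod = rest ++ e ∷ Ss ++ Fs
  cod↭ : cod ↭ rest ++ Ss ++ e ∷ Fs
  cod↭ = ++⁺ˡ rest (↭-sym (shift e Ss Fs))

expand-single : ∀ e Ps {Ss} y rest c Fs → Ss ↭ y ∷ rest → Unique (y ∷ Ps ++ e ∷ rest ++ Fs) →
  χ (allows (just e) y) * matchings (blockRows Ps Ss c) (Ps ++ e ∷ rest ++ Fs)
  ≡ patternCount (length Ps) (length Ss ∸ 1) (suc c) (suc (length Fs))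
expand-single e Ps {Ss} y rest c Fs p u@(_ ∷ u′) = begin
  χ (allows (just e) y) * matchings (blockRows Ps Ss c) cod
    ≡⟨ χ-allows-fresh (matchings (blockRows Ps Ss c) cod) u (∈-++⁺ʳ Ps (here refl)) ⟩
  matchings (blockRows Ps Ss c) cod
    ≡⟨ matchings-resp-↭ʳ (blockRows-↭-single Ps y rest c p) cod ⟩
  matchings (just y ∷ blockRows Ps rest c) cod
    ≡⟨ matchings-prune y (blockRows Ps rest c) cod (Unique[x∷xs]⇒x∉xs u) ⟩
  matchings (nothing ∷ blockRows Ps rest c) cod
    ≡⟨ matchings-resp-↭ʳ (blockRows-suc Ps rest c) cod ⟩
  matchings (blockRows Ps rest (suc c)) cod
    ≡⟨ matchings-resp-↭ᶜ (blockRows Ps rest (suc c)) cod↭ ⟩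
  blockCount Ps rest (suc c) (e ∷ Fs)
    ≡⟨ blockCount≡patternCount Ps rest (suc c) (e ∷ Fs) (unique-resp-↭ cod↭ u′) ⟩
  patternCount (length Ps) (length rest) (suc c) (suc (length Fs))
    ≡⟨ cong (λ b → patternCount (length Ps) b (suc c) (suc (length Fs))) (length-pick p) ⟩
  patternCount (length Ps) (length Ss ∸ 1) (suc c) (suc (length Fs)) ∎
  where
  open ≡-Reasoning
  cod = Ps ++ e ∷ rest ++ Fs
  cod↭ : cod ↭ Ps ++ rest ++ e ∷ Fs
  cod↭ = ++⁺ˡ Ps (↭-sym (shift e rest Fs))

expand-unused : ∀ e Ps Ss c {Fs} y rest → Fs ↭ y ∷ rest → Unique (y ∷ Ps ++ e ∷ Ss ++ rest) →
  χ (allows (just e) y) * matchings (blockRows Ps Ss c) (Ps ++ e ∷ Ss ++ rest)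
  ≡ patternCount (length Ps) (length Ss) c (length Fs)
expand-unused e Ps Ss c {Fs} y rest p u@(_ ∷ u′) = begin
  χ (allows (just e) y) * matchings (blockRows Ps Ss c) cod
    ≡⟨ χ-allows-fresh (matchings (blockRows Ps Ss c) cod) u (∈-++⁺ʳ Ps (here refl)) ⟩
  matchings (blockRows Ps Ss c) cod
    ≡⟨ matchings-resp-↭ᶜ (blockRows Ps Ss c) cod↭ ⟩
  blockCount Ps Ss c (e ∷ rest)
    ≡⟨ blockCount≡patternCount Ps Ss c (e ∷ rest) (unique-resp-↭ cod↭ u′) ⟩
  patternCount (length Ps) (length Ss) c (suc (length rest))
    ≡⟨ cong (patternCount (length Ps) (length Ss) c) (sym (↭-length p)) ⟩
  patternCount (length Ps) (length Ss) c (length Fs) ∎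
  where
  open ≡-Reasoning
  cod = Ps ++ e ∷ Ss ++ rest
  cod↭ : cod ↭ Ps ++ Ss ++ e ∷ rest
  cod↭ = ++⁺ˡ Ps (↭-sym (shift e Ss rest))

-- Expand the row forbidding e along the value y it receives: y is a doubly forbidden value,
-- e itself (impossible), a singly forbidden value, or an unused value.
blockCount-expand : ∀ Ps e Ss c Fs → Unique (Ps ++ e ∷ Ss ++ Fs) →
  blockCount Ps (e ∷ Ss) c Fs
  ≡ length Ps * patternCount (length Ps ∸ 1) (length Ss) (2 + c) (suc (length Fs))
  + (length Ss * patternCount (length Ps) (length Ss ∸ 1) (suc c) (suc (length Fs))
  + length Fs * patternCount (length Ps) (length Ss) c (length Fs))
blockCount-expand Ps e Ss c Fs u = begin
  matchings (doubled Ps ++ just e ∷ map just Ss ++ replicate c nothing) (Ps ++ e ∷ Ss ++ Fs)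
    ≡⟨ matchings-resp-↭ʳ (shift (just e) (doubled Ps) (map just Ss ++ replicate c nothing)) _ ⟩
  pickSum h (Ps ++ e ∷ Ss ++ Fs)
    ≡⟨ pickSum-++ h Ps (e ∷ Ss ++ Fs) ⟩
  pickSum (λ y r → h y (r ++ e ∷ Ss ++ Fs)) Ps
    + (h e (Ps ++ Ss ++ Fs) + pickSum (λ y r → h y (Ps ++ e ∷ r)) (Ss ++ Fs))
    ≡⟨ cong₂ _+_
         (pickSum-uniform Ps (λ y r p → expand-paired e y r Ss c Fs p (unique-resp-↭ (++⁺ʳ (e ∷ Ss ++ Fs) p) u)))
         (cong₂ _+_ (cong (λ b → χ b * _) (allows-self e)) (pickSum-++ (λ y r → h y (Ps ++ e ∷ r)) Ss Fs)) ⟩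
  length Ps * patternCount (length Ps ∸ 1) (length Ss) (2 + c) (suc (length Fs))
    + (pickSum (λ y r → h y (Ps ++ e ∷ (r ++ Fs))) Ss + pickSum (λ y r → h y (Ps ++ e ∷ (Ss ++ r))) Fs)
    ≡⟨ cong (length Ps * patternCount (length Ps ∸ 1) (length Ss) (2 + c) (suc (length Fs)) +_) (cong₂ _+_
         (pickSum-uniform Ss (λ y r p →
            expand-single e Ps y r c Fs p (unique-resp-↭ (toFront Ps (toFront (e ∷ []) (++⁺ʳ Fs p))) u)))
         (pickSum-uniform Fs (λ y r p →
            expand-unused e Ps Ss c y r p (unique-resp-↭ (toFront Ps (toFront (e ∷ []) (toFront Ss p))) u)))) ⟩
  length Ps * patternCount (length Ps ∸ 1) (length Ss) (2 + c) (suc (length Fs))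
    + (length Ss * patternCount (length Ps) (length Ss ∸ 1) (suc c) (suc (length Fs))
    + length Fs * patternCount (length Ps) (length Ss) c (length Fs)) ∎
  where
  open ≡-Reasoning
  h : ℕ → List ℕ → ℕ
  h y rest = χ (allows (just e) y) * matchings (blockRows Ps Ss c) rest

patternCount-suc : ∀ a b c d →
  patternCount a (suc b) c d
  ≡ a * patternCount (a ∸ 1) b (2 + c) (suc d) + (b * patternCount a (b ∸ 1) (suc c) (suc d) + d * patternCount a b c d)
patternCount-suc a b c d =
  trans (blockCount-expand (range 0 a) a (range (suc a) b) c (range (a + suc b) d) u)
        (cong₃ (λ a′ b′ d′ → a′ * patternCount (a′ ∸ 1) b′ (2 + c) (suc d′)
                            + (b′ * patternCount a′ (b′ ∸ 1) (suc c) (suc d′) + d′ * patternCount a′ b′ c d′))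
               (length-range 0 a) (length-range (suc a) b) (length-range (a + suc b) d))
  where
  u : Unique (range 0 a ++ a ∷ range (suc a) b ++ range (a + suc b) d)
  u = subst Unique (sym (range-split a (suc b) d)) (range-unique 0 _)

-- Derangements as matchings

module _ {A : Set} where

  length-filterᵇ : ∀ (p : A → Bool) xs → length (filterᵇ p xs) ≡ sum (map (χ ∘ p) xs)
  length-filterᵇ p []       = refl
  length-filterᵇ p (x ∷ xs) with p x
  ... | true  = cong suc (length-filterᵇ p xs)
  ... | false = length-filterᵇ p xs

  sum-map-cong : ∀ {f g : A → ℕ} → (∀ x → f x ≡ g x) → ∀ xs → sum (map f xs) ≡ sum (map g xs)
  sum-map-cong eq xs = cong sum (map-cong eq xs)

  sum-map-zero : ∀ (xs : List A) → sum (map (λ (_ : A) → 0) xs) ≡ 0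
  sum-map-zero []       = refl
  sum-map-zero (x ∷ xs) = sum-map-zero xs

  sum-map-+ : ∀ (f g : A → ℕ) xs → sum (map (λ x → f x + g x) xs) ≡ sum (map f xs) + sum (map g xs)
  sum-map-+ f g []       = refl
  sum-map-+ f g (x ∷ xs) = trans (cong (f x + g x +_) (sum-map-+ f g xs)) (interchange (f x) (g x) _ _)

  sum-map-filter : ∀ {P : A → Set} (P? : Decidable P) (K : A → ℕ) xs →
    sum (map (λ x → χ (does (P? x)) * K x) xs) ≡ sum (map K (filter P? xs))
  sum-map-filter P? K []       = refl
  sum-map-filter P? K (x ∷ xs) with does (P? x)
  ... | true  = cong₂ _+_ (+-identityʳ (K x)) (sum-map-filter P? K xs)
  ... | false = sum-map-filter P? K xs

  sum-map-χ∧ : ∀ b (p : A → Bool) xs → sum (map (λ x → χ (b ∧ p x)) xs) ≡ χ b * sum (map (χ ∘ p) xs)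
  sum-map-χ∧ true  p xs = sym (+-identityʳ _)
  sum-map-χ∧ false p xs = sum-map-zero xs

module _ {A B : Set} where

  sum-map-comm : ∀ (G : A → B → ℕ) xs ys →
    sum (map (λ y → sum (map (λ x → G x y) xs)) ys) ≡ sum (map (λ x → sum (map (G x) ys)) xs)
  sum-map-comm G xs []       = sym (sum-map-zero xs)
  sum-map-comm G xs (y ∷ ys) = trans (cong (sum (map (λ x → G x y) xs) +_) (sum-map-comm G xs ys))
    (sym (sum-map-+ (λ x → G x y) (λ x → sum (map (G x) ys)) xs))

  sum-map-concatMap : ∀ (F : B → ℕ) (G : A → List B) xs →
    sum (map F (concatMap G xs)) ≡ sum (map (λ x → sum (map F (G x))) xs)
  sum-map-concatMap F G []       = refl
  sum-map-concatMap F G (x ∷ xs) = trans (cong sum (map-++ F (G x) (concatMap G xs)))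
    (trans (sum-++ (map F (G x)) _) (cong (sum (map F (G x)) +_) (sum-map-concatMap F G xs)))

_≢?_ : ∀ (z y : ℕ) → Dec (z ≢ y)
z ≢? y = ¬? (z ≟ y)

_∖_ : List ℕ → ℕ → List ℕ
cod ∖ y = filter (_≢? y) cod

pickSum-∖ : ∀ (H : ℕ → List ℕ → ℕ) cod → Unique cod → pickSum H cod ≡ sum (map (λ y → H y (cod ∖ y)) cod)
pickSum-∖ H []       _             = refl
pickSum-∖ H (z ∷ zs) (z≢zs ∷ uzs) = cong₂ _+_ (cong (H z) (sym remove-z))
  (trans (pickSum-∖ (λ y r → H y (z ∷ r)) zs uzs) (cong sum (map-cong-All (All.map keep-z z≢zs))))
  where
  remove-z : (z ∷ zs) ∖ z ≡ zs
  remove-z = trans (filter-reject (_≢? z) (λ z≢z → z≢z refl)) (filter-all (_≢? z) (All.map (_∘′ sym) z≢zs))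
  keep-z : ∀ {y} → z ≢ y → H y (z ∷ zs ∖ y) ≡ H y ((z ∷ zs) ∖ y)
  keep-z {y} z≢y = cong (H y) (sym (filter-accept (_≢? y) z≢y))

sum-indicator : ∀ (K : ℕ → ℕ) {U cod} → Unique U → Unique cod → All (_∈ U) cod →
                sum (map (λ y → χ (does (y ∈? cod)) * K y) U) ≡ sum (map K cod)
sum-indicator K {U} {cod} uU ucod cod⊆U =
  trans (sum-map-filter (_∈? cod) K U) (sum-↭ (map⁺ K selected↭cod))
  where
  selected↭cod : filter (_∈? cod) U ↭ cod
  selected↭cod = ∼bag⇒↭ (unique∧set⇒bag (Unique.filter⁺ (_∈? cod) uU) ucod
    (mk⇔ (proj₂ ∘′ ∈-filter⁻ (_∈? cod) {xs = U}) (λ y∈ → ∈-filter⁺ (_∈? cod) (All.lookup cod⊆U y∈) y∈)))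

sum-allFin : ∀ n (g : ℕ → ℕ) → sum (map (g ∘ toℕ) (allFin n)) ≡ sum (map g (range 0 n))
sum-allFin n g = cong sum (trans (map-tabulate id (g ∘ toℕ)) (tabulate-range g n 0))

vecSum : ∀ {n} m → (Vec (Fin n) m → ℕ) → ℕ
vecSum {n} m F = sum (map F (allVecs m n))

vecSum-suc : ∀ {n} m (F : Vec (Fin n) (suc m) → ℕ) →
             vecSum (suc m) F ≡ sum (map (λ x → vecSum m (λ v → F (x ∷ v))) (allFin n))
vecSum-suc {n} m F = begin
  sum (map F (concatMap (λ v → map (_∷ v) (allFin n)) (allVecs m n)))
    ≡⟨ sum-map-concatMap F (λ v → map (_∷ v) (allFin n)) (allVecs m n) ⟩
  sum (map (λ v → sum (map F (map (_∷ v) (allFin n)))) (allVecs m n))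
    ≡⟨ sum-map-cong (λ v → cong sum (sym (map-∘ (allFin n)))) (allVecs m n) ⟩
  sum (map (λ v → sum (map (λ x → F (x ∷ v)) (allFin n))) (allVecs m n))
    ≡⟨ sum-map-comm (λ x v → F (x ∷ v)) (allFin n) (allVecs m n) ⟩
  sum (map (λ x → vecSum m (λ v → F (x ∷ v))) (allFin n)) ∎
  where open ≡-Reasoning

isMatching : ∀ {n m} → (Fin m → Maybe ℕ) → List ℕ → Vec (Fin n) m → Bool
isMatching R cod []      = true
isMatching R cod (x ∷ v) =
  (does (toℕ x ∈? cod) ∧ allows (R fzero) (toℕ x)) ∧ isMatching (R ∘ fsuc) (cod ∖ toℕ x) v

χ-∧-* : ∀ a b c → χ (a ∧ b) * c ≡ χ a * (χ b * c)
χ-∧-* true  b c = sym (+-identityʳ _)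
χ-∧-* false b c = refl

vecSum-isMatching : ∀ {n} m (R : Fin m → Maybe ℕ) cod → Unique cod → All (_∈ range 0 n) cod →
                    vecSum {n} m (χ ∘ isMatching R cod) ≡ matchings (tabulate R) cod
vecSum-isMatching         zero    R cod u cod⊆ = refl
vecSum-isMatching {n} (suc m) R cod u cod⊆ = begin
  vecSum (suc m) (χ ∘ isMatching R cod)
    ≡⟨ vecSum-suc m (χ ∘ isMatching R cod) ⟩
  sum (map (λ x → vecSum m (λ v → χ (chosen x ∧ isMatching (R ∘ fsuc) (cod ∖ toℕ x) v))) (allFin n))
    ≡⟨ sum-map-cong (λ x → sum-map-χ∧ (chosen x) _ (allVecs m n)) (allFin n) ⟩
  sum (map (λ x → χ (chosen x) * vecSum m (χ ∘ isMatching (R ∘ fsuc) (cod ∖ toℕ x))) (allFin n))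
    ≡⟨ sum-map-cong (λ x → trans (cong (χ (chosen x) *_) (recurse (toℕ x)))
                                 (χ-∧-* (does (toℕ x ∈? cod)) _ _)) (allFin n) ⟩
  sum (map (λ x → χ (does (toℕ x ∈? cod)) * H (toℕ x) (cod ∖ toℕ x)) (allFin n))
    ≡⟨ sum-allFin n (λ y → χ (does (y ∈? cod)) * H y (cod ∖ y)) ⟩
  sum (map (λ y → χ (does (y ∈? cod)) * H y (cod ∖ y)) (range 0 n))
    ≡⟨ sum-indicator (λ y → H y (cod ∖ y)) (range-unique 0 n) u cod⊆ ⟩
  sum (map (λ y → H y (cod ∖ y)) cod)
    ≡⟨ pickSum-∖ H cod u ⟨
  matchings (tabulate R) cod ∎
  where
  open ≡-Reasoning
  chosen : Fin n → Bool
  chosen x = does (toℕ x ∈? cod) ∧ allows (R fzero) (toℕ x)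
  H : ℕ → List ℕ → ℕ
  H y rest = χ (allows (R fzero) y) * matchings (tabulate (R ∘ fsuc)) rest
  recurse : ∀ y → vecSum m (χ ∘ isMatching (R ∘ fsuc) (cod ∖ y)) ≡ matchings (tabulate (R ∘ fsuc)) (cod ∖ y)
  recurse y = vecSum-isMatching m (R ∘ fsuc) (cod ∖ y) (Unique.filter⁺ (_≢? y) u) (All.filter⁺ (_≢? y) cod⊆)

T-all : ∀ {A : Set} (p : A → Bool) xs → T (all p xs) ⇔ All (T ∘ p) xs
T-all p []       = mk⇔ (λ _ → []) (λ _ → tt)
T-all p (x ∷ xs) = mk⇔
  (λ t → let tx , txs = Equivalence.to T-∧ t in tx ∷ Equivalence.to (T-all p xs) txs)
  (λ { (tx ∷ txs) → Equivalence.from T-∧ (tx , Equivalence.from (T-all p xs) txs) })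

T-all-allFin : ∀ {n} (p : Fin n → Bool) → T (all p (allFin n)) ⇔ (∀ i → T (p i))
T-all-allFin {n} p = mk⇔
  (λ t i → All.lookup (Equivalence.to (T-all p (allFin n)) t) (∈-allFin i))
  (λ h → Equivalence.from (T-all p (allFin n)) (All.tabulate (λ {i} _ → h i)))

T-does⁻ : ∀ {P : Set} (d : Dec P) → T (does d) → P
T-does⁻ d t = toWitness (subst T (sym (isYes≗does d)) t)

T-does⁺ : ∀ {P : Set} (d : Dec P) → P → T (does d)
T-does⁺ d p = subst T (isYes≗does d) (fromWitness p)

T-ext : ∀ {a b} → (T a → T b) → (T b → T a) → a ≡ b
T-ext {a} {b} to from = ⇔→≡ {z = true} (mk⇔ (Equivalence.to T-≡ ∘′ to ∘′ Equivalence.from T-≡)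
                                            (Equivalence.to T-≡ ∘′ from ∘′ Equivalence.from T-≡))

module _ {n : ℕ} where

  T-isPermutation : (g : Vec (Fin n) n) → T (isPermutation g) ⇔ Injective _≡_ _≡_ (lookup g)
  T-isPermutation g = mk⇔ sound complete
    where
    sound : T (isPermutation g) → Injective _≡_ _≡_ (lookup g)
    sound t {i} {j} gi≡gj with lookup g i ≟ᶠ lookup g j | i ≟ᶠ j
                             | Equivalence.to (T-all-allFin _) (Equivalence.to (T-all-allFin _) t i) j
    ... | _        | yes i≡j | _ = i≡j
    ... | no gi≢gj | no _    | _ = ⊥-elim (gi≢gj gi≡gj)
    complete : Injective _≡_ _≡_ (lookup g) → T (isPermutation g)
    complete inj with T? (isPermutation g)
    ... | yes t = t
    ... | no ¬t with ¬∀⟶∃¬ n _ (λ i → T? _) (¬t ∘′ Equivalence.from (T-all-allFin _))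
    ...   | i , ¬tᵢ with ¬∀⟶∃¬ n _ (λ j → T? _) (¬tᵢ ∘′ Equivalence.from (T-all-allFin _))
    ...     | j , ¬tᵢⱼ with lookup g i ≟ᶠ lookup g j | i ≟ᶠ j | ¬tᵢⱼ
    ...       | yes gi≡gj | no i≢j | _   = ⊥-elim (i≢j (inj gi≡gj))
    ...       | yes _     | yes _  | ¬tt = ⊥-elim (¬tt tt)
    ...       | no _      | _      | ¬tt = ⊥-elim (¬tt tt)

  T-avoids : (f : PartialFun n) (g : Vec (Fin n) n) →
             T (avoids f g) ⇔ (∀ i → T (allows (Maybe.map toℕ (f i)) (toℕ (lookup g i))))
  T-avoids f g = mk⇔ sound complete
    where
    sound : T (avoids f g) → ∀ i → T (allows (Maybe.map toℕ (f i)) (toℕ (lookup g i)))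
    sound t i with f i | Equivalence.to (T-all-allFin _) t i
    ... | nothing | _  = tt
    ... | just j  | tᵢ with lookup g i ≟ᶠ j | tᵢ
    ...   | no gi≢j | _ = T-allows-≢ (gi≢j ∘′ toℕ-injective)
    complete : (∀ i → T (allows (Maybe.map toℕ (f i)) (toℕ (lookup g i)))) → T (avoids f g)
    complete h with T? (avoids f g)
    ... | yes t = t
    ... | no ¬t with ¬∀⟶∃¬ n _ (λ i → T? _) (¬t ∘′ Equivalence.from (T-all-allFin _))
    ...   | i , ¬tᵢ with f i | h i | ¬tᵢ
    ...     | nothing | _ | ¬tt = ⊥-elim (¬tt tt)
    ...     | just j  | hᵢ | ¬tᵢ′ with lookup g i ≟ᶠ j | ¬tᵢ′
    ...       | yes refl | _   = ⊥-elim (T-allows⇒≢ {toℕ j} hᵢ refl)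
    ...       | no _     | ¬tt = ⊥-elim (¬tt tt)

  Matches : ∀ {m} → (Fin m → Maybe ℕ) → List ℕ → Vec (Fin n) m → Set
  Matches R cod v = Injective _≡_ _≡_ (lookup v)
                  × (∀ i → toℕ (lookup v i) ∈ cod)
                  × (∀ i → T (allows (R i) (toℕ (lookup v i))))

  isMatching-sound : ∀ {m} (R : Fin m → Maybe ℕ) cod (v : Vec (Fin n) m) → T (isMatching R cod v) → Matches R cod v
  isMatching-sound R cod []      _ = (λ { {()} }) , (λ ()) , (λ ())
  isMatching-sound R cod (x ∷ v) t = inj , inCod , allowed
    where
    tHead = proj₁ (Equivalence.to T-∧ t)
    rest = isMatching-sound (R ∘ fsuc) (cod ∖ toℕ x) v (proj₂ (Equivalence.to T-∧ t))
    fresh : ∀ i → toℕ (lookup v i) ≢ toℕ x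
    fresh i = proj₂ (∈-filter⁻ (_≢? toℕ x) {xs = cod} (proj₁ (proj₂ rest) i))
    inj : Injective _≡_ _≡_ (lookup (x ∷ v))
    inj {fzero}  {fzero}  _  = refl
    inj {fzero}  {fsuc j} eq = ⊥-elim (fresh j (cong toℕ (sym eq)))
    inj {fsuc i} {fzero}  eq = ⊥-elim (fresh i (cong toℕ eq))
    inj {fsuc i} {fsuc j} eq = cong fsuc (proj₁ rest eq)
    inCod : ∀ i → toℕ (lookup (x ∷ v) i) ∈ cod
    inCod fzero    = T-does⁻ (toℕ x ∈? cod) (proj₁ (Equivalence.to T-∧ tHead))
    inCod (fsuc i) = proj₁ (∈-filter⁻ (_≢? toℕ x) {xs = cod} (proj₁ (proj₂ rest) i))
    allowed : ∀ i → T (allows (R i) (toℕ (lookup (x ∷ v) i)))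
    allowed fzero    = proj₂ (Equivalence.to T-∧ tHead)
    allowed (fsuc i) = proj₂ (proj₂ rest) i

  isMatching-complete : ∀ {m} (R : Fin m → Maybe ℕ) cod (v : Vec (Fin n) m) → Matches R cod v → T (isMatching R cod v)
  isMatching-complete R cod []      _                       = tt
  isMatching-complete R cod (x ∷ v) (inj , inCod , allowed) =
    Equivalence.from T-∧ (Equivalence.from T-∧ (T-does⁺ (toℕ x ∈? cod) (inCod fzero) , allowed fzero) ,
                          isMatching-complete (R ∘ fsuc) (cod ∖ toℕ x) v (inj′ , inCod′ , λ i → allowed (fsuc i)))
    where
    inj′ : Injective _≡_ _≡_ (lookup v)
    inj′ eq = Fin.suc-injective (inj eq)
    inCod′ : ∀ i → toℕ (lookup v i) ∈ cod ∖ toℕ x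
    inCod′ i = ∈-filter⁺ (_≢? toℕ x) (inCod (fsuc i)) (λ eq → case inj {fsuc i} {fzero} (toℕ-injective eq) of λ ())

derangements≡matchings : ∀ {n} (f : PartialFun n) →
                         derangements f ≡ matchings (tabulate (Maybe.map toℕ ∘ f)) (range 0 n)
derangements≡matchings {n} f = begin
  length (filterᵇ (λ g → isPermutation g ∧ avoids f g) (allVecs n n))
    ≡⟨ length-filterᵇ (λ g → isPermutation g ∧ avoids f g) (allVecs n n) ⟩
  vecSum n (λ g → χ (isPermutation g ∧ avoids f g))
    ≡⟨ sum-map-cong (λ g → cong χ (T-ext (derangement⇒matching g) (matching⇒derangement g))) (allVecs n n) ⟩
  vecSum n (χ ∘ isMatching R (range 0 n))
    ≡⟨ vecSum-isMatching n R (range 0 n) (range-unique 0 n) (All.tabulate id) ⟩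
  matchings (tabulate R) (range 0 n) ∎
  where
  open ≡-Reasoning
  R : Fin n → Maybe ℕ
  R = Maybe.map toℕ ∘ f
  derangement⇒matching : ∀ g → T (isPermutation g ∧ avoids f g) → T (isMatching R (range 0 n) g)
  derangement⇒matching g t = let tPerm , tAvoids = Equivalence.to T-∧ t in
    isMatching-complete R (range 0 n) g
      ( Equivalence.to (T-isPermutation g) tPerm
      , (λ i → range-∈ 0 n (toℕ<n (lookup g i)))
      , Equivalence.to (T-avoids f g) tAvoids)
  matching⇒derangement : ∀ g → T (isMatching R (range 0 n) g) → T (isPermutation g ∧ avoids f g)
  matching⇒derangement g t = let inj , _ , allowed = isMatching-sound R (range 0 n) g t in
    Equivalence.from T-∧ (Equivalence.from (T-isPermutation g) inj , Equivalence.from (T-avoids f g) allowed)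

-- The canonical partial 2-max function

clamp-toℕ : ∀ {n} (d : Fin n) k → k < n → toℕ (clamp d k) ≡ k
clamp-toℕ {n} d k k<n with k <? n
... | yes k<n′ = toℕ-fromℕ< k<n′
... | no  k≮n  = ⊥-elim (k≮n k<n)

canonicalRow : ℕ → ℕ → ℕ → Maybe ℕ
canonicalRow A B j with j <? A
... | yes _ = just (j / 2)
... | no  _ with j <? A + B
...   | yes _ = just (A / 2 + (j ∸ A))
...   | no  _ = nothing

toℕ-canonical : ∀ A B C (i : Fin (A + B + C)) → Maybe.map toℕ (canonical A B C i) ≡ canonicalRow A B (toℕ i)
toℕ-canonical A B C i with toℕ i <? A
... | yes _ = cong just (clamp-toℕ i (toℕ i / 2) (≤-<-trans (m/n≤m (toℕ i) 2) (toℕ<n i)))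
... | no i≮A with toℕ i <? A + B
...   | yes _ = cong just (clamp-toℕ i _ (≤-<-trans single≤i (toℕ<n i)))
  where
  single≤i : A / 2 + (toℕ i ∸ A) ≤ toℕ i
  single≤i = ≤-trans (+-monoˡ-≤ (toℕ i ∸ A) (m/n≤m A 2)) (≤-reflexive (m+[n∸m]≡n (≮⇒≥ i≮A)))
...   | no _ = refl

range-map-cong : ∀ {X : Set} (h h′ : ℕ → X) s s′ k → (∀ i → i < k → h (s + i) ≡ h′ (s′ + i)) →
                 map h (range s k) ≡ map h′ (range s′ k)
range-map-cong h h′ s s′ zero    eq = refl
range-map-cong h h′ s s′ (suc k) eq = cong₂ _∷_
  (trans (cong h (sym (+-identityʳ s))) (trans (eq 0 (s≤s z≤n)) (cong h′ (+-identityʳ s′))))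
  (range-map-cong h h′ (suc s) (suc s′) k λ i i<k →
    trans (cong h (sym (+-suc s i))) (trans (eq (suc i) (s≤s i<k)) (cong h′ (+-suc s′ i))))

[1+2s]/2≡s : ∀ s → suc (s * 2) / 2 ≡ s
[1+2s]/2≡s zero    = refl
[1+2s]/2≡s (suc s) = trans (m/n≡1+[m∸n]/n {suc (suc (suc (s * 2)))} {2} (s≤s (s≤s z≤n))) (cong suc ([1+2s]/2≡s s))

map-half-range : ∀ s k → map (λ j → just (j / 2)) (range (s * 2) (k * 2)) ≡ doubled (range s k)
map-half-range s zero    = refl
map-half-range s (suc k) = cong₂ (λ u w → just u ∷ w) (m*n/n≡m s 2)
  (cong₂ (λ u w → just u ∷ w) ([1+2s]/2≡s s) (map-half-range (suc s) k))

map-const-range : ∀ {X : Set} (x : X) s k → map (λ _ → x) (range s k) ≡ replicate k x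
map-const-range x s zero    = refl
map-const-range x s (suc k) = cong (x ∷_) (map-const-range x (suc s) k)

canonicalRows-paired : ∀ a B → map (canonicalRow (a * 2) B) (range 0 (a * 2)) ≡ doubled (range 0 a)
canonicalRows-paired a B =
  trans (range-map-cong (canonicalRow (a * 2) B) (λ j → just (j / 2)) 0 0 (a * 2) row) (map-half-range 0 a)
  where
  row : ∀ i → i < a * 2 → canonicalRow (a * 2) B i ≡ just (i / 2)
  row i i<A with i <? a * 2
  ... | yes _   = refl
  ... | no  i≮A = ⊥-elim (i≮A i<A)

canonicalRows-single : ∀ a B → map (canonicalRow (a * 2) B) (range (a * 2) B) ≡ map just (range a B)
canonicalRows-single a B = range-map-cong (canonicalRow A B) just A a B row
  where
  A = a * 2
  row : ∀ i → i < B → canonicalRow A B (A + i) ≡ just (a + i)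
  row i i<B with A + i <? A
  ... | yes A+i<A = ⊥-elim (m+n≮m A i A+i<A)
  ... | no _ with A + i <? A + B
  ...   | yes _       = cong just (cong₂ _+_ (m*n/n≡m a 2) (m+n∸m≡n A i))
  ...   | no  A+i≮A+B = ⊥-elim (A+i≮A+B (+-monoʳ-< A i<B))

canonicalRows-unused : ∀ A B C → map (canonicalRow A B) (range (A + B) C) ≡ replicate C nothing
canonicalRows-unused A B C =
  trans (range-map-cong (canonicalRow A B) (λ _ → nothing) (A + B) (A + B) C row) (map-const-range nothing (A + B) C)
  where
  row : ∀ i → i < C → canonicalRow A B (A + B + i) ≡ nothing
  row i _ with A + B + i <? A
  ... | yes lt = ⊥-elim (≤⇒≯ (≤-trans (m≤m+n A B) (m≤m+n (A + B) i)) lt)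
  ... | no _ with A + B + i <? A + B
  ...   | yes lt = ⊥-elim (m+n≮m (A + B) i lt)
  ...   | no _   = refl

canonical-rows : ∀ a B C →
  tabulate (Maybe.map toℕ ∘ canonical (a * 2) B C) ≡ blockRows (range 0 a) (range a B) C
canonical-rows a B C = begin
  tabulate (Maybe.map toℕ ∘ canonical A B C)
    ≡⟨ tabulate-cong (toℕ-canonical A B C) ⟩
  tabulate (λ i → canonicalRow A B (0 + toℕ i))
    ≡⟨ tabulate-range (canonicalRow A B) (A + B + C) 0 ⟩
  map (canonicalRow A B) (range 0 (A + B + C))
    ≡⟨ cong (map (canonicalRow A B)) (trans (cong (range 0) (+-assoc A B C)) (sym (range-split A B C))) ⟩
  map (canonicalRow A B) (range 0 A ++ range A B ++ range (A + B) C)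
    ≡⟨ trans (map-++ (canonicalRow A B) (range 0 A) _) (cong (map (canonicalRow A B) (range 0 A) ++_)
                                                          (map-++ (canonicalRow A B) (range A B) _)) ⟩
  map (canonicalRow A B) (range 0 A) ++ map (canonicalRow A B) (range A B) ++ map (canonicalRow A B) (range (A + B) C)
    ≡⟨ cong₂ _++_ (canonicalRows-paired a B) (cong₂ _++_ (canonicalRows-single a B) (canonicalRows-unused A B C)) ⟩
  blockRows (range 0 a) (range a B) C ∎
  where
  open ≡-Reasoning
  A = a * 2

-- Of the 2a + B + C values, a + B are forbidden, which leaves a + C unused ones.
D≡patternCount : ∀ a B C {c d} → C ≡ c → a + C ≡ d → D (a * 2) B C ≡ patternCount a B c d
D≡patternCount a B C refl refl = begin
  D (a * 2) B C
    ≡⟨ derangements≡matchings (canonical (a * 2) B C) ⟩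
  matchings (tabulate (Maybe.map toℕ ∘ canonical (a * 2) B C)) (range 0 (a * 2 + B + C))
    ≡⟨ cong₂ matchings (canonical-rows a B C) (trans (cong (range 0) (size a B C)) (sym (range-split a B (a + C)))) ⟩
  patternCount a B C (a + C) ∎
  where
  open ≡-Reasoning
  size : ∀ a B C → a * 2 + B + C ≡ a + (B + (a + C))
  size = solve-∀

D-recurrence : ∀ a b C →
  D (suc a * 2) (suc b) C
  ≡ (C + suc a) * D (suc a * 2) b C + b * D (suc a * 2) (b ∸ 1) (C + 1) + suc a * D (a * 2) b (C + 2)
D-recurrence a b C = begin
  D (suc a * 2) (suc b) C
    ≡⟨ D≡patternCount (suc a) (suc b) C refl refl ⟩
  patternCount (suc a) (suc b) C (suc a + C)
    ≡⟨ patternCount-suc (suc a) b C (suc a + C) ⟩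
  suc a * patternCount a b (2 + C) (suc (suc a + C))
    + (b * patternCount (suc a) (b ∸ 1) (suc C) (suc (suc a + C)) + (suc a + C) * patternCount (suc a) b C (suc a + C))
    ≡⟨ cong₃ (λ x y z → suc a * x + (b * y + (suc a + C) * z))
             (D≡patternCount a b (C + 2) (+-comm C 2) (shift₂ a C))
             (D≡patternCount (suc a) (b ∸ 1) (C + 1) (+-comm C 1) (shift₁ a C))
             (D≡patternCount (suc a) b C refl refl) ⟨
  suc a * D (a * 2) b (C + 2) + (b * D (suc a * 2) (b ∸ 1) (C + 1) + (suc a + C) * D (suc a * 2) b C)
    ≡⟨ regroup (suc a) b C _ _ _ ⟩
  (C + suc a) * D (suc a * 2) b C + b * D (suc a * 2) (b ∸ 1) (C + 1) + suc a * D (a * 2) b (C + 2) ∎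
  where
  open ≡-Reasoning
  shift₁ : ∀ a C → suc a + (C + 1) ≡ suc (suc a + C)
  shift₁ = solve-∀
  shift₂ : ∀ a C → a + (C + 2) ≡ suc (suc a + C)
  shift₂ = solve-∀
  regroup : ∀ x b C X Y Z → x * X + (b * Y + (x + C) * Z) ≡ (C + x) * Z + b * Y + x * X
  regroup = solve-∀

mainTheorem3 : (A B C : ℕ) → 2 ∣ A → 0 < A → 0 < B →
    D A B C ≡ (C + A / 2) * D A (B ∸ 1) C
              + (B ∸ 1) * D A (B ∸ 2) (C + 1)
              + (A / 2) * D (A ∸ 2) (B ∸ 1) (C + 2)
mainTheorem3 _ (suc b) C (divides (suc a) refl) _ _ rewrite m*n/n≡m (suc a) 2 ⦃ _ ⦄ = D-recurrence a b C
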